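{- Let $X$ be a finite set, let $\mathcal{F}$ be a union-closed family of subsets of $X$ with $\bigcup_{f\in\mathcal{F}}f=X$, let $a\in X$ and let $g\in\mathcal{F}$ with $a\notin g$. Then there is $\eta\in\max(\mathrm{Fib}(g))$ with $a\notin\eta$ if and only if there is $h\in\mathcal{F}$ with $a\in h$ such that $h$ covers $g$ in $\mathcal{F}$.
   Context: Union-closed: $f,g\in\mathcal{F}\Rightarrow f\cup g\in\mathcal{F}$. $h$ covers $g$ in $\mathcal{F}$ (written $g\lessdot h$) if $g\subsetneq h$ and there is no $k\in\mathcal{F}$ with $g\subsetneq k\subsetneq h$. $\min(\mathcal{F})^{\uparrow}=\{z\subseteq X:\exists h\in\min(\mathcal{F}),\ h\subseteq z\}$, where $\min(\mathcal{F})$ is the set of inclusion-minimal members; for $z\in\min(\mathcal{F})^{\uparrow}$, $z^*=\bigcup_{\{h\in\mathcal{F}:h\subseteq z\}}h$; $\mathrm{Fib}(g)=\{z\in\min(\mathcal{F})^{\uparrow}:z^*=g\}$ and $\max(\mathrm{Fib}(g))$ denotes its inclusion-maximal elements. -}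

module Defs where

open import Level using (0ℓ)
open import Data.Nat using (ℕ; zero; suc)
open import Data.Bool using (true; false)
open import Data.Vec using (_∷_; [])
open import Data.List using (List; []; _∷_; map; _++_; filter)
open import Data.Product using (Σ; ∃; _×_; _,_)
open import Data.Fin using (Fin)
open import Data.Fin.Subset using (Subset; _∈_; _∉_; _⊆_; _⊂_; _∪_; ⋃)
open import Data.Fin.Subset.Properties using (_⊆?_)
open import Relation.Nullary using (¬_)
open import Relation.Nullary.Decidable using (_×-dec_)
open import Relation.Unary using (Pred; Decidable)
open import Relation.Binary.PropositionalEquality using (_≡_)

-- The ground set X is Fin n; a family 𝓕 of subsets of X is a predicate on Subset n.
Family : ℕ → Set₁
Family n = Pred (Subset n) 0ℓ

allSubsets : (n : ℕ) → List (Subset n)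
allSubsets zero = [] ∷ []
allSubsets (suc n) = map (true ∷_) (allSubsets n) ++ map (false ∷_) (allSubsets n)

module _ {n : ℕ} where

  UnionClosed : Family n → Set
  UnionClosed 𝓕 = ∀ f g → 𝓕 f → 𝓕 g → 𝓕 (f ∪ g)

  CoversGround : Family n → Set
  CoversGround 𝓕 = ∀ (x : Fin n) → ∃ λ f → 𝓕 f × x ∈ f

  Covers : Family n → Subset n → Subset n → Set
  Covers 𝓕 g h = g ⊂ h × (¬ (∃ λ k → 𝓕 k × g ⊂ k × k ⊂ h))

  IsMinimal : Family n → Subset n → Set
  IsMinimal 𝓕 h = 𝓕 h × (∀ k → 𝓕 k → k ⊆ h → k ≡ h)

  InMinUp : Family n → Subset n → Set
  InMinUp 𝓕 z = ∃ λ h → IsMinimal 𝓕 h × h ⊆ z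

  star : (𝓕 : Family n) → Decidable 𝓕 → Subset n → Subset n
  star 𝓕 𝓕? z = ⋃ (filter (λ h → 𝓕? h ×-dec (h ⊆? z)) (allSubsets n))

  InFib : (𝓕 : Family n) → Decidable 𝓕 → Subset n → Subset n → Set
  InFib 𝓕 𝓕? g z = InMinUp 𝓕 z × star 𝓕 𝓕? z ≡ g

  InMaxFib : (𝓕 : Family n) → Decidable 𝓕 → Subset n → Subset n → Set
  InMaxFib 𝓕 𝓕? g η = InFib 𝓕 𝓕? g η × (∀ z → InFib 𝓕 𝓕? g z → η ⊆ z → z ≡ η)

module Submission where

-- For g ∈ 𝓕 and any z ⊆ X write "𝓕 jumps above g inside z"
-- when some h ∈ 𝓕 satisfies g ⊂ h ⊆ z.  Since z* is the least upper bound
-- of the members of 𝓕 below z and 𝓕 is union-closed, z ∈ Fib(g) holds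
-- exactly when g ⊆ z and 𝓕 does not jump above g inside z (every such z
-- lies in min(𝓕)↑ because g does).  Both directions then follow:
--  (⇒) if η ∈ max(Fib(g)) and a ∉ η, then η ∪ {a} ∉ Fib(g), so 𝓕 jumps
--      above g inside η ∪ {a}; an inclusion-minimal jump h covers g, and
--      a ∈ h because h ⊈ η.
--  (⇐) if h covers g and a ∈ h, then g ∪ (h ∖ {a}) lies in Fib(g) and
--      avoids a; a maximal such set η avoiding a is maximal in Fib(g),
--      since any larger member of Fib(g) containing a would contain h.

open import Defs
open import Level using (0ℓ)
open import Data.Nat using (ℕ)
open import Data.Fin using (Fin)
open import Data.Fin.Properties using (¬∀⟶∃¬) renaming (_≟_ to _≟ᶠ_)
open import Data.Fin.Subset
  using (Subset; _∈_; _∉_; _⊆_; _⊈_; _⊂_; _⊃_; _∪_; _∩_; ∁; ⁅_⁆; ⋃; inside; outside)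
open import Data.Fin.Subset.Properties
open import Data.Fin.Subset.Induction using (Acc; acc; ⊂-wellFounded; ⊃-wellFounded)
open import Data.Product using (∃; _×_; _,_; proj₁; proj₂)
open import Data.Sum using (_⊎_; inj₁; inj₂)
open import Data.Vec using (_∷_; [])
open import Data.List using (List; []; _∷_; map; filter)
open import Data.List.Relation.Unary.Any using (here; there)
import Data.List.Membership.Propositional as List
open import Data.List.Membership.Propositional.Properties
  using (∈-map⁺; ∈-++⁺ˡ; ∈-++⁺ʳ; ∈-filter⁺; ∈-filter⁻)
open import Data.Empty using (⊥-elim)
open import Function using (_∘_)
open import Function.Bundles using (_⇔_; mk⇔)
open import Induction.WellFounded using (WellFounded)
open import Relation.Binary.Core using (Rel)
open import Relation.Binary.Definitions using (Transitive) renaming (Decidable to Decidable₂)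
open import Relation.Binary.PropositionalEquality using (_≡_; refl; sym; subst)
open import Relation.Nullary using (¬_; yes; no; ¬?; contradiction)
open import Relation.Nullary.Decidable using (_×-dec_; _→-dec_; decidable-stable)
open import Relation.Unary using (Pred; Decidable)

module _ {n : ℕ} where

  ⊈-witness : {p q : Subset n} → p ⊈ q → ∃ λ x → x ∈ p × x ∉ q
  ⊈-witness {p} {q} p⊈q =
    let (x , x∈p⇏x∈q) = ¬∀⟶∃¬ n (λ x → x ∈ p → x ∈ q)
                          (λ x → (x ∈? p) →-dec (x ∈? q)) (λ f → p⊈q (f _))
    in x , decidable-stable (x ∈? p) (λ x∉p → x∈p⇏x∈q (λ x∈p → contradiction x∈p x∉p))
         , λ x∈q → x∈p⇏x∈q (λ _ → x∈q)

  ⊆∧⊄⇒≡ : {p q : Subset n} → p ⊆ q → ¬ p ⊂ q → p ≡ q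
  ⊆∧⊄⇒≡ {p} {q} p⊆q p⊄q with q ⊆? p
  ... | yes q⊆p = ⊆-antisym p⊆q q⊆p
  ... | no  q⊈p = contradiction ((λ {_} → p⊆q) , ⊈-witness q⊈p) p⊄q

  ∪-least : {p q r : Subset n} → p ⊆ r → q ⊆ r → p ∪ q ⊆ r
  ∪-least {p} {q} p⊆r q⊆r x∈p∪q with x∈p∪q⁻ p q x∈p∪q
  ... | inj₁ x∈p = p⊆r x∈p
  ... | inj₂ x∈q = q⊆r x∈q

  ∉∪ : {x : Fin n} {p q : Subset n} → x ∉ p → x ∉ q → x ∉ p ∪ q
  ∉∪ {p = p} {q} x∉p x∉q x∈p∪q with x∈p∪q⁻ p q x∈p∪q
  ... | inj₁ x∈p = x∉p x∈p
  ... | inj₂ x∈q = x∉q x∈q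

  ⊆∪⁅⁆⇒⊆ : {a : Fin n} {p q : Subset n} → q ⊆ p ∪ ⁅ a ⁆ → a ∉ q → q ⊆ p
  ⊆∪⁅⁆⇒⊆ {a} {p} q⊆p+a a∉q {x} x∈q with x∈p∪q⁻ p ⁅ a ⁆ (q⊆p+a x∈q)
  ... | inj₁ x∈p = x∈p
  ... | inj₂ x∈a = contradiction (subst (_∈ _) (x∈⁅y⁆⇒x≡y a x∈a) x∈q) a∉q

  _without_ : Subset n → Fin n → Subset n
  p without a = p ∩ ∁ ⁅ a ⁆

  without-⊆ : (p : Subset n) (a : Fin n) → p without a ⊆ p
  without-⊆ p a = p∩q⊆p p (∁ ⁅ a ⁆)

  ∉without : (p : Subset n) (a : Fin n) → a ∉ p without a
  ∉without p a a∈ = x∈∁p⇒x∉p (proj₂ (x∈p∩q⁻ p _ a∈)) (x∈⁅x⁆ a)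

  without-⊆⇒⊆ : {a : Fin n} {p z : Subset n} → p without a ⊆ z → a ∈ z → p ⊆ z
  without-⊆⇒⊆ {a} p∖a⊆z a∈z {x} x∈p with x ≟ᶠ a
  ... | yes refl = a∈z
  ... | no  x≢a  = p∖a⊆z (x∈p∩q⁺ (x∈p , x∉p⇒x∈∁p (x≢y⇒x∉⁅y⁆ x≢a)))

  ⋃-upper : {L : List (Subset n)} {p : Subset n} → p List.∈ L → p ⊆ ⋃ L
  ⋃-upper {q ∷ L} (here refl) = p⊆p∪q (⋃ L)
  ⋃-upper {q ∷ L} (there p∈L) = q⊆p∪q q (⋃ L) ∘ ⋃-upper p∈L

  ⋃-least : (L : List (Subset n)) {w : Subset n} → (∀ p → p List.∈ L → p ⊆ w) → ⋃ L ⊆ w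
  ⋃-least []      _     x∈ = contradiction x∈ ∉⊥
  ⋃-least (p ∷ L) bound x∈ with x∈p∪q⁻ p (⋃ L) x∈
  ... | inj₁ x∈p = bound p (here refl) x∈p
  ... | inj₂ x∈L = ⋃-least L (λ q → bound q ∘ there) x∈L

allSubsets-complete : {n : ℕ} (p : Subset n) → p List.∈ allSubsets n
allSubsets-complete []            = here refl
allSubsets-complete (inside ∷ p)  = ∈-++⁺ˡ (∈-map⁺ (inside ∷_) (allSubsets-complete p))
allSubsets-complete (outside ∷ p) =
  ∈-++⁺ʳ (map (inside ∷_) (allSubsets _)) (∈-map⁺ (outside ∷_) (allSubsets-complete p))

module _ {n : ℕ} {_≺_ : Rel (Subset n) 0ℓ} (≺-trans : Transitive _≺_)
         (≺-wellFounded : WellFounded _≺_) (_≺?_ : Decidable₂ _≺_)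
         {Q : Pred (Subset n) 0ℓ} (Q? : Decidable Q) where

  ≺-minimal : ∀ {z} → Q z → ∃ λ m → Q m × (m ≡ z ⊎ m ≺ z) × (∀ k → Q k → ¬ k ≺ m)
  ≺-minimal = descend _ (≺-wellFounded _)
    where
    descend : ∀ z → Acc _≺_ z → Q z → ∃ λ m → Q m × (m ≡ z ⊎ m ≺ z) × (∀ k → Q k → ¬ k ≺ m)
    descend z (acc smaller) Qz with anySubset? (λ k → Q? k ×-dec (k ≺? z))
    ... | no  none = z , Qz , inj₁ refl , λ k Qk k≺z → none (k , Qk , k≺z)
    ... | yes (k , Qk , k≺z) with descend k (smaller k≺z) Qk
    ...   | m , Qm , inj₁ refl , least = m , Qm , inj₂ k≺z , least
    ...   | m , Qm , inj₂ m≺k  , least = m , Qm , inj₂ (≺-trans m≺k k≺z) , least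

module _ {n : ℕ} {Q : Pred (Subset n) 0ℓ} (Q? : Decidable Q) where

  ⊂-minimal : ∀ {z} → Q z → ∃ λ m → Q m × m ⊆ z × (∀ k → Q k → ¬ k ⊂ m)
  ⊂-minimal Qz with ≺-minimal ⊂-trans ⊂-wellFounded _⊂?_ Q? Qz
  ... | m , Qm , inj₁ refl , least = m , Qm , ⊆-refl , least
  ... | m , Qm , inj₂ m⊂z  , least = m , Qm , proj₁ m⊂z , least

  ⊃-maximal : ∀ {z} → Q z → ∃ λ m → Q m × z ⊆ m × (∀ k → Q k → ¬ m ⊂ k)
  ⊃-maximal Qz with ≺-minimal {_≺_ = _⊃_} (λ p q → ⊂-trans q p) ⊃-wellFounded
                               (λ p q → q ⊂? p) Q? Qz
  ... | m , Qm , inj₁ refl , greatest = m , Qm , ⊆-refl , greatest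
  ... | m , Qm , inj₂ z⊂m  , greatest = m , Qm , proj₁ z⊂m , greatest

module Star {n : ℕ} (𝓕 : Family n) (𝓕? : Decidable 𝓕) where

  below? : (z : Subset n) → Decidable (λ h → 𝓕 h × h ⊆ z)
  below? z h = 𝓕? h ×-dec (h ⊆? z)

  star-upper : ∀ {z h} → 𝓕 h → h ⊆ z → h ⊆ star 𝓕 𝓕? z
  star-upper {z} {h} 𝓕h h⊆z = ⋃-upper (∈-filter⁺ (below? z) (allSubsets-complete h) (𝓕h , h⊆z))

  star-least : ∀ {z w} → (∀ h → 𝓕 h → h ⊆ z → h ⊆ w) → star 𝓕 𝓕? z ⊆ w
  star-least {z} bound = ⋃-least (filter (below? z) (allSubsets _)) λ h h∈ →
    let (𝓕h , h⊆z) = proj₂ (∈-filter⁻ (below? z) {xs = allSubsets _} h∈) in bound h 𝓕h h⊆z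

module Fibre {n : ℕ} (𝓕 : Family n) (𝓕? : Decidable 𝓕) (closed : UnionClosed 𝓕)
             {g : Subset n} (𝓕g : 𝓕 g) where
  open Star 𝓕 𝓕?

  JumpWithin : Subset n → Set
  JumpWithin z = ∃ λ h → 𝓕 h × g ⊂ h × h ⊆ z

  jumpWithin? : Decidable JumpWithin
  jumpWithin? z = anySubset? (λ h → 𝓕? h ×-dec (g ⊂? h) ×-dec (h ⊆? z))

  ⊇g⇒minUp : ∀ {z} → g ⊆ z → InMinUp 𝓕 z
  ⊇g⇒minUp g⊆z with ⊂-minimal 𝓕? 𝓕g
  ... | m , 𝓕m , m⊆g , least =
    m , (𝓕m , λ k 𝓕k k⊆m → ⊆∧⊄⇒≡ k⊆m (least k 𝓕k)) , g⊆z ∘ m⊆g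

  fibre-intro : ∀ {z} → g ⊆ z → ¬ JumpWithin z → InFib 𝓕 𝓕? g z
  fibre-intro {z} g⊆z noJump =
    ⊇g⇒minUp g⊆z , ⊆-antisym (star-least below-g) (star-upper 𝓕g g⊆z)
    where
    -- a member h ⊆ z lies below g, or else h ∪ g would jump above g inside z
    below-g : ∀ h → 𝓕 h → h ⊆ z → h ⊆ g
    below-g h 𝓕h h⊆z = subst (h ⊆_) (sym g≡h∪g) (p⊆p∪q g)
      where
      g≡h∪g : g ≡ h ∪ g
      g≡h∪g = ⊆∧⊄⇒≡ (q⊆p∪q h g) λ g⊂h∪g →
        noJump (h ∪ g , closed h g 𝓕h 𝓕g , g⊂h∪g , ∪-least h⊆z g⊆z)

  fibre-elim : ∀ {z} → InFib 𝓕 𝓕? g z → g ⊆ z × ¬ JumpWithin z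
  fibre-elim {z} (_ , z*≡g) = subst (_⊆ z) z*≡g (star-least λ _ _ h⊆z → h⊆z) , noJump
    where
    noJump : ¬ JumpWithin z
    noJump (h , 𝓕h , (_ , x , x∈h , x∉g) , h⊆z) =
      x∉g (subst (_ ∈_) z*≡g (star-upper 𝓕h h⊆z x∈h))

  covering-jump : ∀ {z} → JumpWithin z → ∃ λ h → 𝓕 h × h ⊆ z × Covers 𝓕 g h
  covering-jump {z} (h , jump) with ⊂-minimal (λ h → 𝓕? h ×-dec (g ⊂? h) ×-dec (h ⊆? z)) jump
  ... | m , (𝓕m , g⊂m , m⊆z) , _ , least =
    m , 𝓕m , m⊆z , g⊂m , λ (k , 𝓕k , g⊂k , k⊂m) → least k (𝓕k , g⊂k , m⊆z ∘ proj₁ k⊂m) k⊂m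

  -- A maximal element η of Fib(g) avoiding a cannot be enlarged by a within
  -- the fibre, so 𝓕 jumps above g inside η ∪ {a}.
  enlarged-maxFibre-jumps : ∀ {a η} → InMaxFib 𝓕 𝓕? g η → a ∉ η → JumpWithin (η ∪ ⁅ a ⁆)
  enlarged-maxFibre-jumps {a} {η} (η∈Fib , maximal) a∉η =
    decidable-stable (jumpWithin? _) λ noJump →
      a∉η (subst (a ∈_) (maximal _ (fibre-intro (η⊆η+a ∘ proj₁ (fibre-elim η∈Fib)) noJump) η⊆η+a)
                        (q⊆p∪q η ⁅ a ⁆ (x∈⁅x⁆ a)))
    where
    η⊆η+a : η ⊆ η ∪ ⁅ a ⁆
    η⊆η+a = p⊆p∪q ⁅ a ⁆

  -- (⇒) A covering jump h inside η ∪ {a} contains a, since h ⊈ η.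
  maxFibre⇒cover : ∀ {a} → (∃ λ η → InMaxFib 𝓕 𝓕? g η × a ∉ η) →
                   ∃ λ h → 𝓕 h × a ∈ h × Covers 𝓕 g h
  maxFibre⇒cover {a} (η , η∈maxFib , a∉η)
    with covering-jump (enlarged-maxFibre-jumps η∈maxFib a∉η)
  ... | h , 𝓕h , h⊆η+a , g⋖h = h , 𝓕h , decidable-stable (a ∈? h) a∉h-impossible , g⋖h
    where
    a∉h-impossible : ¬ a ∉ h
    a∉h-impossible a∉h =
      proj₂ (fibre-elim (proj₁ η∈maxFib)) (h , 𝓕h , proj₁ g⋖h , ⊆∪⁅⁆⇒⊆ h⊆η+a a∉h)

  -- If h covers g and a ∈ h ∖ g, then 𝓕 does not jump above g inside
  -- g ∪ (h without a): such a jump would lie strictly between g and h.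
  cover-without-noJump : ∀ {a h} → a ∉ g → a ∈ h → Covers 𝓕 g h →
                         ¬ JumpWithin (g ∪ (h without a))
  cover-without-noJump {a} {h} a∉g a∈h (g⊂h , nothingBetween) (k , 𝓕k , g⊂k , k⊆z₀) =
    nothingBetween (k , 𝓕k , g⊂k , z₀⊆h ∘ k⊆z₀ , a , a∈h , ∉∪ a∉g (∉without h a) ∘ k⊆z₀)
    where
    z₀⊆h : g ∪ (h without a) ⊆ h
    z₀⊆h = ∪-least (proj₁ g⊂h) (without-⊆ h a)

  -- (⇐) Take η maximal among the sets above g ∪ (h without a) that avoid a
  -- and admit no jump.  It lies in Fib(g), and it is maximal there: a larger
  -- member of the fibre avoiding a equals η by choice of η, while one
  -- containing a would contain h and hence jump above g.
  cover⇒maxFibre : ∀ {a} → a ∉ g → (∃ λ h → 𝓕 h × a ∈ h × Covers 𝓕 g h) →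
                   ∃ λ η → InMaxFib 𝓕 𝓕? g η × a ∉ η
  cover⇒maxFibre {a} a∉g (h , 𝓕h , a∈h , g⋖h)
    with ⊃-maximal (λ z → ¬? (jumpWithin? z) ×-dec ¬? (a ∈? z))
                   (cover-without-noJump a∉g a∈h g⋖h , ∉∪ a∉g (∉without h a))
  ... | η , (noJumpη , a∉η) , z₀⊆η , greatest =
    η , (fibre-intro (z₀⊆η ∘ p⊆p∪q _) noJumpη , maximal) , a∉η
    where
    maximal : ∀ z → InFib 𝓕 𝓕? g z → η ⊆ z → z ≡ η
    maximal z z∈Fib η⊆z with a ∈? z
    ... | yes a∈z = ⊥-elim (proj₂ (fibre-elim z∈Fib) (h , 𝓕h , proj₁ g⋖h , h⊆z))
      where
      h⊆z : h ⊆ z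
      h⊆z = without-⊆⇒⊆ (η⊆z ∘ z₀⊆η ∘ q⊆p∪q g _) a∈z
    ... | no a∉z = sym (⊆∧⊄⇒≡ η⊆z (greatest z (proj₂ (fibre-elim z∈Fib) , a∉z)))

lemma4p7 : (n : ℕ) (𝓕 : Family n) (𝓕? : Decidable 𝓕) →
           UnionClosed 𝓕 → CoversGround 𝓕 →
           (a : Fin n) (g : Subset n) → 𝓕 g → a ∉ g →
           (∃ λ η → InMaxFib 𝓕 𝓕? g η × a ∉ η) ⇔ (∃ λ h → 𝓕 h × a ∈ h × Covers 𝓕 g h)
lemma4p7 n 𝓕 𝓕? closed _ a g 𝓕g a∉g = mk⇔ maxFibre⇒cover (cover⇒maxFibre a∉g)
  where open Fibre 𝓕 𝓕? closed 𝓕g
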